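{- Let $\Delta$ be the root system of type $A_n$ (of $\mathfrak{sl}_{n+1}$) with simple roots $\alpha_i=\varepsilon_i-\varepsilon_{i+1}$, $i=1,\dots,n$. Identify every positive root $\alpha_i+\alpha_{i+1}+\dots+\alpha_j$ ($i\le j$) with its support, the interval $[i,j]=\{i,i+1,\dots,j\}\subseteq[n]=\{1,\dots,n\}$. Define $\Phi:\mathrm{Ab}(\mathfrak{sl}_{n+1})\to 2^{[n]}$ by \[ \Phi(I)=\mathrm{supp}(\gamma_1)\oplus\cdots\oplus\mathrm{supp}(\gamma_k), \] where $\gamma_1,\dots,\gamma_k$ are the generators of $I$ and $\oplus$ denotes symmetric difference of subsets of $[n]$ (with $\Phi(\varnothing)=\varnothing$). Then $\Phi$ is a bijection between $\mathrm{Ab}(\mathfrak{sl}_{n+1})$ and the set $2^{[n]}$ of all subsets of $[n]$. Moreover, if $I$ has $k$ generators, then $\Phi(I)$ has $k$ connected components (i.e. is a disjoint union of exactly $k$ maximal intervals of consecutive integers).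
   Context: $\Delta^+$ is partially ordered by the root order: $\nu\preccurlyeq\mu$ iff $\mu-\nu$ is a non-negative integral combination of simple roots. $\mathrm{Ab}(\mathfrak{sl}_{n+1})$ denotes the set of subsets $I\subseteq\Delta^+$ that are upper ideals (if $\nu\in I$, $\gamma\in\Delta^+$, $\nu\preccurlyeq\gamma$ then $\gamma\in I$) and satisfy $\gamma'+\gamma''\notin\Delta^+$ for all $\gamma',\gamma''\in I$; these correspond to the abelian ideals of a Borel subalgebra. The generators of $I$ are its minimal elements. The connected components of a subset of $[n]$ are taken with respect to the path graph $1-2-\cdots-n$ (the Dynkin diagram of $A_n$). -}

module Defs where

open import Data.Nat as ℕ using (ℕ; zero; suc; _+_)
import Data.Nat.Properties as ℕP
open import Data.Bool using (Bool; true; false; _∧_; _xor_; if_then_else_)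
import Data.Bool.Properties as BoolP
open import Data.Fin using (Fin; toℕ; _≤_; _≤?_)
import Data.Fin.Properties as FinP
open import Data.Fin.Subset using (Subset; ⊥; _∈_; _∉_)
open import Data.Vec using (Vec; tabulate; zipWith)
open import Data.List using (List; []; _∷_; concatMap; filter; foldr; map; length)
open import Data.Product using (Σ; ∃; _×_; _,_)
open import Data.Empty using () renaming (⊥ to Empty)
open import Relation.Nullary using (Dec; yes; no; ¬_)
open import Relation.Nullary.Decidable using (_×-dec_; _→-dec_; map′; ¬?)
open import Relation.Binary.PropositionalEquality using (_≡_; refl; cong; subst)

-- Positive roots of A_n.  We use 0-indexing: the simple root α_{k+1}
-- corresponds to k : Fin n.  A positive root α_i + … + α_j (i ≤ j) is
-- recorded by its endpoints.

record Root (n : ℕ) : Set where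
  constructor root
  field
    lo  : Fin n
    hi  : Fin n
    lo≤hi : lo ≤ hi
open Root public

inSupp : ∀ {n} → Root n → Fin n → Bool
inSupp r k = (toℕ (lo r) ℕ.≤ᵇ toℕ k) ∧ (toℕ k ℕ.≤ᵇ toℕ (hi r))

coeff : ∀ {n} → Root n → Fin n → ℕ
coeff r k = if inSupp r k then 1 else 0

supp : ∀ {n} → Root n → Subset n
supp r = tabulate (inSupp r)

_≼_ : ∀ {n} → Root n → Root n → Set
ν ≼ μ = ∀ k → coeff ν k ℕ.≤ coeff μ k

IsPosRoot : ∀ {n} → (Fin n → ℕ) → Set
IsPosRoot {n} v = ∃ λ (r : Root n) → ∀ k → coeff r k ≡ v k

RootSet : ℕ → Set
RootSet n = Root n → Bool

_∈R_ : ∀ {n} → Root n → RootSet n → Set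
r ∈R I = I r ≡ true

record IsAb {n} (I : RootSet n) : Set where
  field
    upper   : ∀ ν γ → ν ∈R I → ν ≼ γ → γ ∈R I
    abelian : ∀ γ′ γ″ → γ′ ∈R I → γ″ ∈R I →
              ¬ IsPosRoot (λ k → coeff γ′ k + coeff γ″ k)

IsGen : ∀ {n} → RootSet n → Root n → Set
IsGen I γ = γ ∈R I × (∀ ν → ν ∈R I → ν ≼ γ → ν ≡ γ)

allRoots : ∀ n → List (Root n)
allRoots n = concatMap (λ a → concatMap (λ b → f a b (a ≤? b))
                                        (Data.List.allFin n)) (Data.List.allFin n)
  where
  f : (a b : Fin n) → Dec (a ≤ b) → List (Root n)
  f a b (yes p) = root a b p ∷ []
  f a b (no _)  = []

∀Root? : ∀ {n} {P : Root n → Set} → (∀ r → Dec (P r)) → Dec (∀ r → P r)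
∀Root? {n} {P} P? =
  map′ (λ h → λ { (root a b p) → h a b p }) (λ h a b p → h (root a b p))
       (FinP.all? λ a → FinP.all? λ b → dec a b)
  where
  dec : (a b : Fin n) → Dec (∀ (p : a ≤ b) → P (root a b p))
  dec a b with a ≤? b
  ... | no ¬p = yes λ p → Data.Empty.⊥-elim (¬p p)
    where import Data.Empty
  ... | yes p with P? (root a b p)
  ...   | yes q = yes λ p′ → subst (λ z → P (root a b z)) (ℕP.≤-irrelevant p p′) q
  ...   | no ¬q = no λ h → ¬q (h p)

_≟R_ : ∀ {n} (r s : Root n) → Dec (r ≡ s)
root a b p ≟R root c d q with a FinP.≟ c | b FinP.≟ d
... | yes refl | yes refl = yes (cong (root a b) (ℕP.≤-irrelevant p q))
... | no ne | _ = no λ { refl → ne refl }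
... | _ | no ne = no λ { refl → ne refl }

_≼?_ : ∀ {n} (ν μ : Root n) → Dec (ν ≼ μ)
ν ≼? μ = FinP.all? λ k → coeff ν k ℕP.≤? coeff μ k

IsGen? : ∀ {n} (I : RootSet n) (γ : Root n) → Dec (IsGen I γ)
IsGen? I γ = (I γ BoolP.≟ true) ×-dec
  ∀Root? (λ ν → (I ν BoolP.≟ true) →-dec ((ν ≼? γ) →-dec (ν ≟R γ)))

generators : ∀ {n} → RootSet n → List (Root n)
generators {n} I = filter (IsGen? I) (allRoots n)

_⊕_ : ∀ {n} → Subset n → Subset n → Subset n
_⊕_ = zipWith _xor_

Φ : ∀ {n} → RootSet n → Subset n
Φ I = foldr _⊕_ ⊥ (map supp (generators I))

-- Connected components of a subset S ⊆ [n] w.r.t. the path 1 - 2 - … - n: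
-- maximal intervals [a,b] (a ≤ b) contained in S.  An interval is again
-- recorded as a `Root n` (pair of endpoints a ≤ b).

IsComponent : ∀ {n} → Subset n → Root n → Set
IsComponent S c =
  (∀ k → inSupp c k ≡ true → k ∈ S) ×
  (∀ k → suc (toℕ k) ≡ toℕ (lo c) → k ∉ S) ×
  (∀ k → toℕ k ≡ suc (toℕ (hi c)) → k ∉ S)

IsComponent? : ∀ {n} (S : Subset n) (c : Root n) → Dec (IsComponent S c)
IsComponent? S c =
  FinP.all? (λ k → (inSupp c k BoolP.≟ true) →-dec (k Data.Fin.Subset.Properties.∈? S))
  ×-dec FinP.all? (λ k → (suc (toℕ k) ℕP.≟ toℕ (lo c)) →-dec ¬? (k Data.Fin.Subset.Properties.∈? S))
  ×-dec FinP.all? (λ k → (toℕ k ℕP.≟ suc (toℕ (hi c))) →-dec ¬? (k Data.Fin.Subset.Properties.∈? S))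
  where import Data.Fin.Subset.Properties

components : ∀ {n} → Subset n → List (Root n)
components {n} S = filter (IsComponent? S) (allRoots n)

module Submission where

-- Roots are intervals [l, h] of [0, n), subsets are read as Boolean predicates on ℕ.
-- The central notion is the boundary ∂S (the points p where S changes value between
-- p - 1 and p) and its counting function rank S c = |∂S ∩ [0, c)|.  General facts come
-- first: ∂ is injective and xor-linear, ∂[l, h] = {l, h + 1}, and |∂S| = 2 · #components
-- (telescoping).  For an abelian ideal I with k generators, the generators pairwise
-- overlap and are strictly shifted, so ∂Φ(I) consists of their 2k distinct ends; hence
-- #components Φ(I) = k, and a root [a, b] lies in I iff its window [a, b + 1] holds
-- more than k points of ∂Φ(I).  This criterion gives injectivity; for surjectivity the
-- roots satisfying it for a given S form an abelian ideal whose generators' ends are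
-- exactly ∂S, so its image is S.

open import Defs
open import Data.Nat using (ℕ)
open import Data.Fin.Subset using (Subset)
open import Data.List using (length)
open import Data.Product using (_×_; ∃; _,_)
open import Relation.Binary.PropositionalEquality using (_≡_)

open import Data.Nat as ℕ using (zero; suc; _+_; _∸_; _≤ᵇ_; _<ᵇ_; _≡ᵇ_; z≤n; s≤s)
  renaming (_≤_ to _≤ℕ_; _<_ to _<ℕ_)
open import Data.Nat.Properties
open import Data.Bool using (Bool; true; false; _∧_; _xor_; not)
import Data.Bool.Properties as BoolP
open import Data.Fin as Fin using (Fin; toℕ; fromℕ<)
import Data.Fin.Properties as FinP
open import Data.Fin.Subset using (_∈_; _∉_; ⊥)
open import Data.Vec using ([]; _∷_; lookup)
import Data.Vec.Properties as VecP
open import Data.List as List using (List; []; _∷_; filter; concatMap; allFin)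
open import Data.List.Membership.Propositional using (lose) renaming (_∈_ to _∈L_)
open import Data.List.Membership.Propositional.Properties
  using (∈-concatMap⁺; ∈-concatMap⁻; ∈-allFin; ∈-filter⁺; ∈-filter⁻)
open import Data.List.Relation.Unary.Any using (here; there; satisfied; any?)
import Data.List.Relation.Unary.All as All
import Data.List.Relation.Unary.All.Properties as AllP
open import Data.List.Relation.Unary.AllPairs as AllPairs using ([]; _∷_)
import Data.List.Relation.Unary.AllPairs.Properties as AllPairsP
open import Data.List.Relation.Unary.Unique.Propositional using (Unique)
import Data.List.Relation.Unary.Unique.Propositional.Properties as UniqueP
open import Data.Product using (Σ; proj₁; proj₂)
open import Data.Sum using (_⊎_; inj₁; inj₂)
open import Data.Empty using (⊥-elim) renaming (⊥ to Empty)
open import Function.Bundles using (_⇔_; mk⇔; Equivalence)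
open import Relation.Nullary using (Dec; yes; no; ¬_; does)
open import Relation.Nullary.Decidable using (dec-true; dec-false; _×-dec_; ¬?)
open import Relation.Unary using (Decidable)
open import Relation.Binary.Definitions using (tri<; tri≈; tri>)
open import Relation.Binary.PropositionalEquality
  using (_≢_; refl; sym; trans; cong; cong₂; subst; subst₂; module ≡-Reasoning)
open import Algebra.Bundles using (CommutativeRing)
import Algebra.Properties.CommutativeSemigroup as CommSemigroupProperties
open CommSemigroupProperties +-commutativeSemigroup using () renaming (interchange to +-interchange)
open CommSemigroupProperties (CommutativeRing.+-commutativeSemigroup BoolP.xor-∧-commutativeRing)
  using () renaming (interchange to xor-interchange)

ind : Bool → ℕ
ind true  = 1
ind false = 0

ind≤1 : ∀ b → ind b ≤ℕ 1
ind≤1 true  = s≤s z≤n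
ind≤1 false = z≤n

witness : ∀ {P : Set} (d : Dec P) → does d ≡ true → P
witness (yes p) _ = p

false≢true : false ≢ true
false≢true ()

module _ {A : Set} where

  sumOver : (A → ℕ) → List A → ℕ
  sumOver f []       = 0
  sumOver f (x ∷ xs) = f x + sumOver f xs

  xorOver : (A → Bool) → List A → Bool
  xorOver f []       = false
  xorOver f (x ∷ xs) = f x xor xorOver f xs

  sumOver-cong : ∀ {f g : A → ℕ} xs → (∀ x → x ∈L xs → f x ≡ g x) → sumOver f xs ≡ sumOver g xs
  sumOver-cong []       eq = refl
  sumOver-cong (x ∷ xs) eq = cong₂ _+_ (eq x (here refl)) (sumOver-cong xs (λ y m → eq y (there m)))

  sumOver-mono : ∀ {f g : A → ℕ} xs → (∀ x → x ∈L xs → f x ≤ℕ g x) → sumOver f xs ≤ℕ sumOver g xs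
  sumOver-mono []       le = z≤n
  sumOver-mono (x ∷ xs) le = +-mono-≤ (le x (here refl)) (sumOver-mono xs (λ y m → le y (there m)))

  sumOver-+ : ∀ (f g : A → ℕ) xs → sumOver (λ x → f x + g x) xs ≡ sumOver f xs + sumOver g xs
  sumOver-+ f g []       = refl
  sumOver-+ f g (x ∷ xs) = trans (cong (f x + g x +_) (sumOver-+ f g xs))
                                 (+-interchange (f x) (g x) (sumOver f xs) (sumOver g xs))

  sumOver-term : ∀ (f : A → ℕ) {xs x} → x ∈L xs → f x ≤ℕ sumOver f xs
  sumOver-term f {y ∷ xs} (here refl) = m≤m+n (f y) _
  sumOver-term f {y ∷ xs} (there m)   = ≤-trans (sumOver-term f m) (m≤n+m _ (f y))

  sumOver-zero : ∀ (f : A → ℕ) xs → (∀ x → x ∈L xs → f x ≡ 0) → sumOver f xs ≡ 0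
  sumOver-zero f []       z = refl
  sumOver-zero f (x ∷ xs) z = cong₂ _+_ (z x (here refl)) (sumOver-zero f xs (λ y m → z y (there m)))

  sumOver-one : ∀ (xs : List A) → sumOver (λ _ → 1) xs ≡ length xs
  sumOver-one []       = refl
  sumOver-one (x ∷ xs) = cong suc (sumOver-one xs)

  sumOver-above : ∀ (f : A → ℕ) {xs x₀} → (∀ x → x ∈L xs → 1 ≤ℕ f x) → x₀ ∈L xs → 2 ≤ℕ f x₀ →
                  suc (length xs) ≤ℕ sumOver f xs
  sumOver-above f {x ∷ xs} pos (here refl) two =
    +-mono-≤ two (subst (_≤ℕ sumOver f xs) (sumOver-one xs) (sumOver-mono xs (λ y m → pos y (there m))))
  sumOver-above f {x ∷ xs} pos (there m) two =
    +-mono-≤ (pos x (here refl)) (sumOver-above f (λ y m′ → pos y (there m′)) m two)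

  length-filter : ∀ {P : A → Set} (P? : Decidable P) xs →
                  length (filter P? xs) ≡ sumOver (λ x → ind (does (P? x))) xs
  length-filter P? []       = refl
  length-filter P? (x ∷ xs) with does (P? x)
  ... | true  = cong suc (length-filter P? xs)
  ... | false = length-filter P? xs

  count-atMostOne : ∀ (P : A → Bool) {xs} → Unique xs →
    (∀ {x y} → x ∈L xs → y ∈L xs → P x ≡ true → P y ≡ true → x ≡ y) →
    sumOver (λ x → ind (P x)) xs ≤ℕ 1
  count-atMostOne P {[]}     _          one = z≤n
  count-atMostOne P {x ∷ xs} (x∉ ∷ uxs) one with P x in Px
  ... | false = count-atMostOne P uxs (λ m m′ → one (there m) (there m′))
  ... | true  = ≤-reflexive (cong suc (sumOver-zero (λ y → ind (P y)) xs rest))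
    where
    rest : ∀ y → y ∈L xs → ind (P y) ≡ 0
    rest y m with P y in Py
    ... | false = refl
    ... | true  = ⊥-elim (All.lookup x∉ m (one (here refl) (there m) Px Py))

  xorOver-cong : ∀ {f g : A → Bool} xs → (∀ x → x ∈L xs → f x ≡ g x) → xorOver f xs ≡ xorOver g xs
  xorOver-cong []       eq = refl
  xorOver-cong (x ∷ xs) eq = cong₂ _xor_ (eq x (here refl)) (xorOver-cong xs (λ y m → eq y (there m)))

  xorOver-true : ∀ {f : A → Bool} xs → xorOver f xs ≡ true → ∃ λ x → x ∈L xs × f x ≡ true
  xorOver-true {f} (x ∷ xs) odd with f x in fx
  ... | true  = x , here refl , fx
  ... | false = let (y , y∈ , fy) = xorOver-true xs odd in y , there y∈ , fy

  xorOver-count : ∀ (f : A → Bool) xs → sumOver (λ x → ind (f x)) xs ≤ℕ 1 →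
                  ind (xorOver f xs) ≡ sumOver (λ x → ind (f x)) xs
  xorOver-count f []       _ = refl
  xorOver-count f (x ∷ xs) atMost1 with f x | xorOver-count f xs
  ... | false | ih = ih atMost1
  ... | true  | ih with sumOver (λ y → ind (f y)) xs | xorOver f xs
  ...   | zero  | false = refl
  ...   | zero  | true  = ⊥-elim (1+n≢0 (ih z≤n))
  xorOver-count f (x ∷ xs) (s≤s ()) | true | _ | suc _ | _

ind-+-≤1 : ∀ {x y} → (x ≡ true → y ≡ true → Empty) → ind x + ind y ≤ℕ 1
ind-+-≤1 {false} {y}     _    = ind≤1 y
ind-+-≤1 {true}  {false} _    = s≤s z≤n
ind-+-≤1 {true}  {true}  both = ⊥-elim (both refl refl)

ind-+-≥1 : ∀ {x y} → x ≡ true ⊎ y ≡ true → 1 ≤ℕ ind x + ind y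
ind-+-≥1 (inj₁ refl) = s≤s z≤n
ind-+-≥1 {x} (inj₂ refl) = m≤n+m 1 (ind x)

predecessor : ∀ {b} → 0 <ℕ b → ∃ λ b′ → suc b′ ≡ b
predecessor {suc b′} _ = b′ , refl

halve-injective : ∀ a b → a + a ≡ b + b → a ≡ b
halve-injective zero    zero    _  = refl
halve-injective (suc a) (suc b) eq =
  cong suc (halve-injective a b (suc-injective (trans (sym (+-suc a a)) (trans (suc-injective eq) (+-suc b b)))))

Σ< : ℕ → (ℕ → ℕ) → ℕ
Σ< zero    f = 0
Σ< (suc N) f = Σ< N f + f N

Σ<-zero : ∀ N → Σ< N (λ _ → 0) ≡ 0
Σ<-zero zero    = refl
Σ<-zero (suc N) = trans (+-identityʳ _) (Σ<-zero N)

Σ<-+ : ∀ N (f g : ℕ → ℕ) → Σ< N (λ p → f p + g p) ≡ Σ< N f + Σ< N g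
Σ<-+ zero    f g = refl
Σ<-+ (suc N) f g = trans (cong (_+ (f N + g N)) (Σ<-+ N f g))
                         (+-interchange (Σ< N f) (Σ< N g) (f N) (g N))

Σ<-cong : ∀ N {f g : ℕ → ℕ} → (∀ p → p <ℕ N → f p ≡ g p) → Σ< N f ≡ Σ< N g
Σ<-cong zero    eq = refl
Σ<-cong (suc N) eq = cong₂ _+_ (Σ<-cong N (λ p p<N → eq p (m≤n⇒m≤1+n p<N))) (eq N ≤-refl)

Σ<-sumOver : ∀ {A : Set} N (F : A → ℕ → ℕ) xs →
             Σ< N (λ p → sumOver (λ x → F x p) xs) ≡ sumOver (λ x → Σ< N (F x)) xs
Σ<-sumOver N F []       = Σ<-zero N
Σ<-sumOver N F (x ∷ xs) = trans (Σ<-+ N (F x) (λ p → sumOver (λ y → F y p) xs))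
                                (cong (Σ< N (F x) +_) (Σ<-sumOver N F xs))

Σ<-point : ∀ b a N → Σ< N (λ p → ind (b ∧ (a ≡ᵇ p))) ≡ ind (b ∧ (a <ᵇ N))
Σ<-point false a N       = Σ<-zero N
Σ<-point true  a zero    = refl
Σ<-point true  a (suc N) = trans (cong (_+ ind (a ≡ᵇ N)) (Σ<-point true a N)) (split a N)
  where
  split : ∀ a N → ind (a <ᵇ N) + ind (a ≡ᵇ N) ≡ ind (a <ᵇ suc N)
  split zero    zero    = refl
  split zero    (suc N) = refl
  split (suc a) zero    = refl
  split (suc a) (suc N) = split a N

χ : ∀ {n} → Subset n → ℕ → Bool
χ []      x       = false
χ (b ∷ S) zero    = b
χ (b ∷ S) (suc x) = χ S x

χ-lookup : ∀ {n} (S : Subset n) k → lookup S k ≡ χ S (toℕ k)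
χ-lookup (b ∷ S) Fin.zero    = refl
χ-lookup (b ∷ S) (Fin.suc k) = χ-lookup S k

χ-outside : ∀ {n} (S : Subset n) {x} → n ≤ℕ x → χ S x ≡ false
χ-outside []      _         = refl
χ-outside (b ∷ S) (s≤s n≤x) = χ-outside S n≤x

χ-below : ∀ {n} (S : Subset n) x → χ S x ≡ true → x <ℕ n
χ-below {n} S x χx with x ℕ.<? n
... | yes x<n = x<n
... | no  x≮n with trans (sym (χ-outside S (≮⇒≥ x≮n))) χx
...   | ()

χ-ext : ∀ {n} (S T : Subset n) → (∀ x → χ S x ≡ χ T x) → S ≡ T
χ-ext []      []      eq = refl
χ-ext (a ∷ S) (b ∷ T) eq = cong₂ _∷_ (eq zero) (χ-ext S T (λ x → eq (suc x)))

-- The boundary of a predicate s on ℕ: p is a boundary point when s changes value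
-- between p - 1 and p (with s (-1) read as false).

before : (ℕ → Bool) → ℕ → Bool
before s zero    = false
before s (suc p) = s p

∂ : (ℕ → Bool) → ℕ → Bool
∂ s p = before s p xor s p

∂-cong : ∀ {s t : ℕ → Bool} → (∀ x → s x ≡ t x) → ∀ p → ∂ s p ≡ ∂ t p
∂-cong eq zero    = eq zero
∂-cong eq (suc p) = cong₂ _xor_ (eq p) (eq (suc p))

∂-xor : ∀ (s t : ℕ → Bool) p → ∂ (λ x → s x xor t x) p ≡ ∂ s p xor ∂ t p
∂-xor s t zero    = refl
∂-xor s t (suc p) = xor-interchange (s p) (t p) (s (suc p)) (t (suc p))

∂-xorOver : ∀ {A : Set} (F : A → ℕ → Bool) xs p →
            ∂ (λ x → xorOver (λ a → F a x) xs) p ≡ xorOver (λ a → ∂ (F a) p) xs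
∂-xorOver F []       zero    = refl
∂-xorOver F []       (suc p) = refl
∂-xorOver F (a ∷ xs) p = trans (∂-xor (F a) (λ x → xorOver (λ b → F b x) xs) p)
                               (cong (∂ (F a) p xor_) (∂-xorOver F xs p))

∂-injective : ∀ (s t : ℕ → Bool) → (∀ p → ∂ s p ≡ ∂ t p) → ∀ x → s x ≡ t x
∂-injective s t eq zero    = eq zero
∂-injective s t eq (suc x) = cancel (∂-injective s t eq x) (eq (suc x))
  where
  cancel : ∀ {a b c d} → a ≡ b → a xor c ≡ b xor d → c ≡ d
  cancel {false} refl e = e
  cancel {true} {c = false} {false} refl e = refl
  cancel {true} {c = false} {true}  refl ()
  cancel {true} {c = true}  {false} refl ()
  cancel {true} {c = true}  {true}  refl e = refl

<ᵇ-suc : ∀ x h → (x <ᵇ suc h) ≡ (x ≤ᵇ h)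
<ᵇ-suc zero    h = refl
<ᵇ-suc (suc x) h = refl

≤ᵇ-suc : ∀ l x → (suc l ≤ᵇ suc x) ≡ (l ≤ᵇ x)
≤ᵇ-suc zero    x = refl
≤ᵇ-suc (suc l) x = refl

inInterval : ℕ → ℕ → ℕ → Bool
inInterval l h x = (l ≤ᵇ x) ∧ (x ≤ᵇ h)

∂-interval : ∀ l h → l ≤ℕ h → ∀ p → ∂ (inInterval l h) p ≡ (l ≡ᵇ p) xor (suc h ≡ᵇ p)
∂-interval l h l≤h p = begin
  ∂ (inInterval l h) p                      ≡⟨ ∂-cong (asSteps l h l≤h) p ⟩
  ∂ (λ x → (l ≤ᵇ x) xor (suc h ≤ᵇ x)) p     ≡⟨ ∂-xor (l ≤ᵇ_) (suc h ≤ᵇ_) p ⟩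
  ∂ (l ≤ᵇ_) p xor ∂ (suc h ≤ᵇ_) p           ≡⟨ cong₂ _xor_ (∂-step l p) (∂-step (suc h) p) ⟩
  (l ≡ᵇ p) xor (suc h ≡ᵇ p)                 ∎
  where
  open ≡-Reasoning
  asSteps : ∀ l h → l ≤ℕ h → ∀ x → inInterval l h x ≡ (l ≤ᵇ x) xor (suc h ≤ᵇ x)
  asSteps zero    zero    z≤n       zero    = refl
  asSteps zero    zero    z≤n       (suc x) = refl
  asSteps zero    (suc h) z≤n       zero    = refl
  asSteps zero    (suc h) z≤n       (suc x) = trans (<ᵇ-suc x h) (asSteps zero h z≤n x)
  asSteps (suc l) (suc h) (s≤s l≤h) zero    = refl
  asSteps (suc l) (suc h) (s≤s l≤h) (suc x) =
    trans (cong₂ _∧_ (≤ᵇ-suc l x) (<ᵇ-suc x h))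
          (trans (asSteps l h l≤h x) (sym (cong₂ _xor_ (≤ᵇ-suc l x) (≤ᵇ-suc (suc h) x))))
  ∂-step : ∀ a p → ∂ (a ≤ᵇ_) p ≡ (a ≡ᵇ p)
  ∂-step zero    zero    = refl
  ∂-step zero    (suc p) = refl
  ∂-step (suc a) zero    = refl
  ∂-step (suc a) (suc p) = shift a p
    where
    shift : ∀ a p → (suc a ≤ᵇ p) xor (suc a ≤ᵇ suc p) ≡ (a ≡ᵇ p)
    shift zero    zero    = refl
    shift zero    (suc p) = refl
    shift (suc a) zero    = refl
    shift (suc a) (suc p) = shift a p

inInterval-intro : ∀ {l h x} → l ≤ℕ x → x ≤ℕ h → inInterval l h x ≡ true
inInterval-intro {l} {h} {x} l≤x x≤h = cong₂ _∧_ (dec-true (l ℕ.≤? x) l≤x) (dec-true (x ℕ.≤? h) x≤h)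

inInterval-elim : ∀ l h x → inInterval l h x ≡ true → l ≤ℕ x × x ≤ℕ h
inInterval-elim l h x eq with l ≤ᵇ x in l≤x | x ≤ᵇ h in x≤h
... | true | true = witness (l ℕ.≤? x) l≤x , witness (x ℕ.≤? h) x≤h

inInterval-below : ∀ {l h x} → x <ℕ l → inInterval l h x ≡ false
inInterval-below {l} {h} {x} x<l = cong (_∧ (x ≤ᵇ h)) (dec-false (l ℕ.≤? x) (<⇒≱ x<l))

inInterval-above : ∀ l {h x} → h <ℕ x → inInterval l h x ≡ false
inInterval-above l {h} {x} h<x with l ≤ᵇ x
... | true  = dec-false (x ℕ.≤? h) (<⇒≱ h<x)
... | false = refl

inInterval-split : ∀ l m h x → l ≤ℕ m → m <ℕ h →
                   ind (inInterval l h x) ≡ ind (inInterval l m x) + ind (inInterval (suc m) h x)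
inInterval-split l m h x l≤m m<h with x ℕ.<? l
... | yes x<l rewrite inInterval-below {l} {h} x<l | inInterval-below {l} {m} x<l
                    | inInterval-below {suc m} {h} {x} (<-≤-trans x<l (m≤n⇒m≤1+n l≤m)) = refl
... | no x≮l with x ℕ.≤? m
...   | yes x≤m rewrite inInterval-intro {l} {h} (≮⇒≥ x≮l) (≤-trans x≤m (<⇒≤ m<h))
                      | inInterval-intro {l} {m} (≮⇒≥ x≮l) x≤m
                      | inInterval-below {suc m} {h} {x} (s≤s x≤m) = refl
...   | no x≰m rewrite inInterval-above l {m} {x} (≰⇒> x≰m) with x ℕ.≤? h
...     | yes x≤h rewrite inInterval-intro {l} {h} (≮⇒≥ x≮l) x≤h
                        | inInterval-intro {suc m} {h} (≰⇒> x≰m) x≤h = refl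
...     | no x≰h rewrite inInterval-above l {h} {x} (≰⇒> x≰h)
                       | inInterval-above (suc m) {h} {x} (≰⇒> x≰h) = refl

below-split : ∀ a h x → a ≤ℕ suc h → ind (x <ᵇ suc h) ≡ ind (x <ᵇ a) + ind (inInterval a h x)
below-split a h x a≤h+1 with x ℕ.<? a
... | yes x<a rewrite dec-true (x ℕ.<? suc h) (<-≤-trans x<a a≤h+1) | dec-true (x ℕ.<? a) x<a
                    | inInterval-below {a} {h} x<a = refl
... | no  x≮a rewrite dec-false (x ℕ.<? a) x≮a | dec-true (a ℕ.≤? x) (≮⇒≥ x≮a) = cong ind (<ᵇ-suc x h)

∂-bounded : ∀ {n} (S : Subset n) p → ∂ (χ S) p ≡ true → p ≤ℕ n
∂-bounded {n} S p ∂p with p ℕ.≤? n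
... | yes p≤n = p≤n
∂-bounded {n} S zero    ∂p | no p≰n = ⊥-elim (p≰n z≤n)
∂-bounded {n} S (suc q) ∂p | no p≰n
  rewrite χ-outside S (≤-pred (≰⇒> p≰n)) | χ-outside S (m≤n⇒m≤1+n (≤-pred (≰⇒> p≰n))) with ∂p
... | ()

rank : (ℕ → Bool) → ℕ → ℕ
rank s c = Σ< c (λ p → ind (∂ s p))

rank-mono : ∀ s {c d} → c ≤ℕ d → rank s c ≤ℕ rank s d
rank-mono s {c} {zero}  z≤n = ≤-refl
rank-mono s {c} {suc d} c≤d with m≤n⇒m<n∨m≡n c≤d
... | inj₂ refl       = ≤-refl
... | inj₁ (s≤s c≤d′) = ≤-trans (rank-mono s c≤d′) (m≤m+n (rank s d) _)

rank-step : ∀ s c → rank s (suc c) ≤ℕ suc (rank s c)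
rank-step s c = subst (rank s c + ind (∂ s c) ≤ℕ_) (+-comm (rank s c) 1)
                      (+-monoʳ-≤ (rank s c) (ind≤1 (∂ s c)))

rank-<⇒< : ∀ s {c d} → rank s c <ℕ rank s d → c <ℕ d
rank-<⇒< s {c} {d} lt with c ℕ.<? d
... | yes c<d = c<d
... | no  c≮d = ⊥-elim (<⇒≱ lt (rank-mono s (≮⇒≥ c≮d)))

rank-attains : ∀ s N t → t <ℕ rank s N → ∃ λ q → q <ℕ N × rank s q ≡ t × ∂ s q ≡ true
rank-attains s zero    t ()
rank-attains s (suc N) t t<rank with t ℕ.<? rank s N
... | yes t<rankN =
  let (q , q<N , rq , ∂q) = rank-attains s N t t<rankN in q , m≤n⇒m≤1+n q<N , rq , ∂q
... | no t≮rankN with ∂ s N in ∂N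
...   | true  = N , ≤-refl , ≤-antisym (≮⇒≥ t≮rankN) (≤-pred (subst (suc t ≤ℕ_) (+-comm (rank s N) 1) t<rank)) , ∂N
...   | false = ⊥-elim (t≮rankN (subst (t <ℕ_) (+-identityʳ (rank s N)) t<rank))

rank-skip : ∀ s x → ∂ s x ≡ false → rank s (suc x) ≡ rank s x
rank-skip s x ∂x = trans (cong (λ b → rank s x + ind b) ∂x) (+-identityʳ (rank s x))

rank-hit : ∀ s x → ∂ s x ≡ true → rank s (suc x) ≡ suc (rank s x)
rank-hit s x ∂x = trans (cong (λ b → rank s x + ind b) ∂x) (+-comm (rank s x) 1)

-- p starts a run of s when s p holds but s (p - 1) does not.  Every run contributes
-- two boundary points, which telescopes to: #boundary points = 2 · #runs.

startsRun : (ℕ → Bool) → ℕ → Bool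
startsRun s p = s p ∧ not (before s p)

runs : (ℕ → Bool) → ℕ → ℕ
runs s N = Σ< N (λ p → ind (startsRun s p))

telescope : ∀ (s : ℕ → Bool) N → rank s N + ind (before s N) ≡ runs s N + runs s N
telescope s zero    = refl
telescope s (suc N) = begin
  rank s N + ind (∂ s N) + ind (s N)                  ≡⟨ +-assoc (rank s N) _ _ ⟩
  rank s N + (ind (∂ s N) + ind (s N))                ≡⟨ cong (rank s N +_) (local (before s N) (s N)) ⟩
  rank s N + (ind (before s N) + (u + u))             ≡⟨ sym (+-assoc (rank s N) _ _) ⟩
  rank s N + ind (before s N) + (u + u)               ≡⟨ cong (_+ (u + u)) (telescope s N) ⟩
  runs s N + runs s N + (u + u)                       ≡⟨ +-interchange (runs s N) (runs s N) u u ⟩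
  runs s (suc N) + runs s (suc N)                     ∎
  where
  open ≡-Reasoning
  u = ind (startsRun s N)
  local : ∀ c x → ind (c xor x) + ind x ≡ ind c + (ind (x ∧ not c) + ind (x ∧ not c))
  local false false = refl
  local false true  = refl
  local true  false = refl
  local true  true  = refl

left right : ∀ {n} → Root n → ℕ
left  r = toℕ (lo r)
right r = toℕ (hi r)

left≤right : ∀ {n} (r : Root n) → left r ≤ℕ right r
left≤right r = lo≤hi r

right<n : ∀ {n} (r : Root n) → right r <ℕ n
right<n r = FinP.toℕ<n (hi r)

mkRoot : ∀ {n} a b → a ≤ℕ b → b <ℕ n → Root n
mkRoot a b a≤b b<n = root (fromℕ< (≤-<-trans a≤b b<n)) (fromℕ< b<n)
  (subst₂ _≤ℕ_ (sym (FinP.toℕ-fromℕ< _)) (sym (FinP.toℕ-fromℕ< b<n)) a≤b)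

left-mkRoot : ∀ {n} a b a≤b (b<n : b <ℕ n) → left (mkRoot a b a≤b b<n) ≡ a
left-mkRoot a b a≤b b<n = FinP.toℕ-fromℕ< (≤-<-trans a≤b b<n)

right-mkRoot : ∀ {n} a b a≤b (b<n : b <ℕ n) → right (mkRoot a b a≤b b<n) ≡ b
right-mkRoot a b a≤b b<n = FinP.toℕ-fromℕ< b<n

pointAt : ∀ {n} x → x <ℕ n → Σ (Fin n) λ k → toℕ k ≡ x
pointAt x x<n = fromℕ< x<n , FinP.toℕ-fromℕ< x<n

root-ext : ∀ {n} (r s : Root n) → left r ≡ left s → right r ≡ right s → r ≡ s
root-ext (root a b p) (root c d q) eqL eqR with FinP.toℕ-injective eqL | FinP.toℕ-injective eqR
... | refl | refl = cong (root a b) (≤-irrelevant p q)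

coeff-ind : ∀ {n} (r : Root n) k → coeff r k ≡ ind (inSupp r k)
coeff-ind r k with inSupp r k
... | true  = refl
... | false = refl

≼⇒⊆ : ∀ {n} (ν μ : Root n) → ν ≼ μ → left μ ≤ℕ left ν × right ν ≤ℕ right μ
≼⇒⊆ ν μ ν≼μ = proj₁ (inμ (lo ν) (inInterval-intro ≤-refl (left≤right ν)))
            , proj₂ (inμ (hi ν) (inInterval-intro (left≤right ν) ≤-refl))
  where
  inμ : ∀ k → inSupp ν k ≡ true → left μ ≤ℕ toℕ k × toℕ k ≤ℕ right μ
  inμ k inν with inSupp μ k in inμk | subst₂ _≤ℕ_ (coeff-ind ν k) (coeff-ind μ k) (ν≼μ k)
  ... | true  | _ = inInterval-elim (left μ) (right μ) (toℕ k) inμk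
  ... | false | c rewrite inν with c
  ...   | ()

⊆⇒≼ : ∀ {n} (ν μ : Root n) → left μ ≤ℕ left ν → right ν ≤ℕ right μ → ν ≼ μ
⊆⇒≼ ν μ lμ≤lν rν≤rμ k rewrite coeff-ind ν k | coeff-ind μ k with inSupp ν k in inν
... | false = z≤n
... | true with inInterval-elim (left ν) (right ν) (toℕ k) inν
...   | lν≤k , k≤rν rewrite inInterval-intro {left μ} {right μ} (≤-trans lμ≤lν lν≤k) (≤-trans k≤rν rν≤rμ) = ≤-refl

≼-refl : ∀ {n} (r : Root n) → r ≼ r
≼-refl r = ⊆⇒≼ r r ≤-refl ≤-refl

≼-trans : ∀ {n} (a b c : Root n) → a ≼ b → b ≼ c → a ≼ c
≼-trans a b c a≼b b≼c =
  ⊆⇒≼ a c (≤-trans (proj₁ (≼⇒⊆ b c b≼c)) (proj₁ (≼⇒⊆ a b a≼b)))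
          (≤-trans (proj₂ (≼⇒⊆ a b a≼b)) (proj₂ (≼⇒⊆ b c b≼c)))

-- Sums of two roots: overlapping roots never add up to a root (their common
-- simple root would get coefficient 2), while adjacent roots always do.

overlapping-sum-not-root : ∀ {n} (γ γ′ : Root n) → left γ′ ≤ℕ right γ → left γ ≤ℕ right γ′ →
                           ¬ IsPosRoot (λ k → coeff γ k + coeff γ′ k)
overlapping-sum-not-root {n} γ γ′ l′≤r l≤r′ (ρ , coeffρ) =
  <⇒≱ (s≤s (s≤s z≤n)) (subst (_≤ℕ 1) (trans (coeffρ k) two) (subst (_≤ℕ 1) (sym (coeff-ind ρ k)) (ind≤1 _)))
  where
  x = left γ ℕ.⊔ left γ′
  x∈γ : left γ ≤ℕ x × x ≤ℕ right γ
  x∈γ = m≤m⊔n (left γ) (left γ′) , ⊔-lub (left≤right γ) l′≤r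
  x∈γ′ : left γ′ ≤ℕ x × x ≤ℕ right γ′
  x∈γ′ = m≤n⊔m (left γ) (left γ′) , ⊔-lub l≤r′ (left≤right γ′)
  k = proj₁ (pointAt x (≤-<-trans (proj₂ x∈γ) (right<n γ)))
  k≡x : toℕ k ≡ x
  k≡x = proj₂ (pointAt x (≤-<-trans (proj₂ x∈γ) (right<n γ)))
  coeff-one : ∀ (r : Root n) → left r ≤ℕ x × x ≤ℕ right r → coeff r k ≡ 1
  coeff-one r (l≤x , x≤r) = trans (coeff-ind r k)
    (cong ind (subst (λ y → inInterval (left r) (right r) y ≡ true) (sym k≡x) (inInterval-intro l≤x x≤r)))
  two : coeff γ k + coeff γ′ k ≡ 2
  two = cong₂ _+_ (coeff-one γ x∈γ) (coeff-one γ′ x∈γ′)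

adjacent-sum-root : ∀ {n} (γ γ′ : Root n) → suc (right γ) ≡ left γ′ →
                    IsPosRoot (λ k → coeff γ k + coeff γ′ k)
adjacent-sum-root γ γ′ adj = root (lo γ) (hi γ′) l≤r′ , λ k → begin
  coeff (root (lo γ) (hi γ′) l≤r′) k
    ≡⟨ coeff-ind (root (lo γ) (hi γ′) l≤r′) k ⟩
  ind (inInterval (left γ) (right γ′) (toℕ k))
    ≡⟨ inInterval-split (left γ) (right γ) (right γ′) (toℕ k) (left≤right γ) r<r′ ⟩
  ind (inInterval (left γ) (right γ) (toℕ k)) + ind (inInterval (suc (right γ)) (right γ′) (toℕ k))
    ≡⟨ cong₂ _+_ (sym (coeff-ind γ k)) (trans (cong (λ a → ind (inInterval a (right γ′) (toℕ k))) adj)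
                                              (sym (coeff-ind γ′ k))) ⟩
  coeff γ k + coeff γ′ k ∎
  where
  open ≡-Reasoning
  r<r′ : right γ <ℕ right γ′
  r<r′ = ≤-trans (≤-reflexive adj) (left≤right γ′)
  l≤r′ : left γ ≤ℕ right γ′
  l≤r′ = ≤-trans (left≤right γ) (<⇒≤ r<r′)

-- Any two members of an abelian ideal overlap: if γ′ lay strictly to the right of γ,
-- enlarging γ up to the point just before γ′ would stay in the ideal and give two
-- adjacent members, whose sum is a root.

abelian-overlap : ∀ {n} {I : RootSet n} → IsAb I → ∀ γ γ′ → γ ∈R I → γ′ ∈R I → left γ′ ≤ℕ right γ
abelian-overlap {n} {I} ab γ γ′ γ∈ γ′∈ with left γ′ ℕ.≤? right γ
... | yes ok    = ok
... | no  apart with predecessor (≤-<-trans z≤n (≰⇒> apart))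
...   | b , suc-b = ⊥-elim (IsAb.abelian ab δ γ′ δ∈ γ′∈ (adjacent-sum-root δ γ′ δ-adj))
  where
  r≤b : right γ ≤ℕ b
  r≤b = ≤-pred (subst (suc (right γ) ≤ℕ_) (sym suc-b) (≰⇒> apart))
  l≤b : left γ ≤ℕ b
  l≤b = ≤-trans (left≤right γ) r≤b
  b<n : b <ℕ n
  b<n = subst (_≤ℕ n) (sym suc-b) (≤-trans (left≤right γ′) (<⇒≤ (right<n γ′)))
  δ = mkRoot (left γ) b l≤b b<n
  δ∈ : δ ∈R I
  δ∈ = IsAb.upper ab γ δ γ∈ (⊆⇒≼ γ δ (≤-reflexive (left-mkRoot _ _ l≤b b<n))
                                      (subst (right γ ≤ℕ_) (sym (right-mkRoot _ _ l≤b b<n)) r≤b))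
  δ-adj : suc (right δ) ≡ left γ′
  δ-adj = trans (cong suc (right-mkRoot _ _ l≤b b<n)) suc-b

concatMap-unique : ∀ {A B : Set} (f : A → List B) (key : B → A) → (∀ x {y} → y ∈L f x → key y ≡ x) →
                   ∀ {xs} → Unique xs → (∀ x → Unique (f x)) → Unique (concatMap f xs)
concatMap-unique f key keyOk uxs uf =
  UniqueP.concat⁺ (AllP.map⁺ (All.universal uf _))
                  (AllPairsP.map⁺ (AllPairs.map disjoint uxs))
  where
  disjoint : ∀ {x x′} → x ≢ x′ → ∀ {y} → ¬ (y ∈L f x × y ∈L f x′)
  disjoint x≢x′ (y∈fx , y∈fx′) = x≢x′ (trans (sym (keyOk _ y∈fx)) (keyOk _ y∈fx′))

-- The enumeration allRoots lists every root exactly once.  Its inner list is the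
-- singleton [root a b] when a ≤ b and empty otherwise; we name it by inference.

private
  allRoots-shape : ∀ n → Σ (Fin n → Fin n → List (Root n)) λ G →
                   allRoots n ≡ concatMap (λ a → concatMap (G a) (allFin n)) (allFin n)
  allRoots-shape n = _ , refl

  cell : ∀ n → Fin n → Fin n → List (Root n)
  cell n = proj₁ (allRoots-shape n)

  cell-∋ : ∀ {n} (a b : Fin n) p → root a b p ∈L cell n a b
  cell-∋ a b p with a Fin.≤? b
  ... | yes q = here (cong (root a b) (≤-irrelevant p q))
  ... | no ¬q = ⊥-elim (¬q p)

  cell-endpoints : ∀ {n} (a b : Fin n) {r} → r ∈L cell n a b → lo r ≡ a × hi r ≡ b
  cell-endpoints a b m with a Fin.≤? b
  cell-endpoints a b (here refl) | yes _ = refl , refl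

  cell-unique : ∀ {n} (a b : Fin n) → Unique (cell n a b)
  cell-unique a b with a Fin.≤? b
  ... | yes _ = All.[] ∷ []
  ... | no  _ = []

∈-allRoots : ∀ {n} (r : Root n) → r ∈L allRoots n
∈-allRoots {n} (root a b p) = subst (root a b p ∈L_) (sym (proj₂ (allRoots-shape n)))
  (∈-concatMap⁺ _ (lose (∈-allFin a) (∈-concatMap⁺ (cell n a) (lose (∈-allFin b) (cell-∋ a b p)))))

allRoots-unique : ∀ n → Unique (allRoots n)
allRoots-unique n = subst Unique (sym (proj₂ (allRoots-shape n)))
  (concatMap-unique _ lo (λ a m → let (b , m′) = satisfied (∈-concatMap⁻ (cell n a) {xs = allFin n} m)
                                   in proj₁ (cell-endpoints a b m′))
     (UniqueP.allFin⁺ n)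
     (λ a → concatMap-unique (cell n a) hi (λ b m → proj₂ (cell-endpoints a b m)) (UniqueP.allFin⁺ n) (cell-unique a)))

-- Every member r of a set of roots lies above a generator (minimal member): if r is
-- not minimal, some other member below it has a strictly shorter support.

width : ∀ {n} → Root n → ℕ
width r = right r ∸ left r

below-narrower : ∀ {n} (ν r : Root n) → ν ≼ r → ν ≢ r → width ν <ℕ width r
below-narrower ν r ν≼r ν≢r with ≼⇒⊆ ν r ν≼r | left r ℕ.≟ left ν | right ν ℕ.≟ right r
... | _ , _         | yes eqL | yes eqR = ⊥-elim (ν≢r (root-ext ν r (sym eqL) eqR))
... | lr≤lν , rν≤rr | no  neL | _       =
  ≤-<-trans (∸-monoˡ-≤ (left ν) rν≤rr) (∸-monoʳ-< (≤∧≢⇒< lr≤lν neL) (≤-trans (left≤right ν) rν≤rr))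
... | lr≤lν , rν≤rr | yes _   | no  neR =
  <-≤-trans (∸-monoˡ-< (≤∧≢⇒< rν≤rr neR) (left≤right ν)) (∸-monoʳ-≤ (right r) lr≤lν)

descent : ∀ {n} (I : RootSet n) r → r ∈R I → ∃ λ g → IsGen I g × g ≼ r
descent {n} I r r∈I = descend (suc (width r)) r ≤-refl r∈I
  where
  StrictlyBelow : Root n → Root n → Set
  StrictlyBelow r ν = ν ∈R I × ν ≼ r × ν ≢ r

  strictlyBelow? : ∀ r ν → Dec (StrictlyBelow r ν)
  strictlyBelow? r ν = (I ν BoolP.≟ true) ×-dec (ν ≼? r) ×-dec ¬? (ν ≟R r)

  descend : ∀ fuel r → width r <ℕ fuel → r ∈R I → ∃ λ g → IsGen I g × g ≼ r
  descend (suc fuel) r w<fuel r∈I with IsGen? I r | any? (strictlyBelow? r) (allRoots n)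
  ... | yes gen | _ = r , gen , ≼-refl r
  ... | no notGen | no none = ⊥-elim (notGen (r∈I , minimal))
    where
    minimal : ∀ ν → ν ∈R I → ν ≼ r → ν ≡ r
    minimal ν ν∈I ν≼r with ν ≟R r
    ... | yes eq  = eq
    ... | no  ν≢r = ⊥-elim (none (lose (∈-allRoots ν) (ν∈I , ν≼r , ν≢r)))
  ... | no _ | yes found =
    let (ν , ν∈I , ν≼r , ν≢r) = satisfied found
        (g , gen , g≼ν) = descend fuel ν (<-≤-trans (below-narrower ν r ν≼r ν≢r) (≤-pred w<fuel)) ν∈I
    in g , gen , ≼-trans g ν r g≼ν ν≼r

-- Components of a subset S ⊆ [n]: each component starts exactly one run of χ S and
-- each run start is the left end of exactly one component.  Hence #components is
-- the number of runs, and by telescoping, half the number of boundary points.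

module Components {n} (S : Subset n) where

  s : ℕ → Bool
  s = χ S

  ∈⇒χ : ∀ {k} → k ∈ S → s (toℕ k) ≡ true
  ∈⇒χ {k} k∈S = trans (sym (χ-lookup S k)) (VecP.[]=⇒lookup k∈S)

  χ⇒∈ : ∀ {k} → s (toℕ k) ≡ true → k ∈ S
  χ⇒∈ {k} sk = VecP.lookup⇒[]= k S (trans (χ-lookup S k) sk)

  component-startsRun : ∀ c → IsComponent S c → startsRun s (left c) ≡ true
  component-startsRun c (inside , leftEdge , _) =
    cong₂ (λ a b → a ∧ not b) (∈⇒χ (inside (lo c) (inInterval-intro ≤-refl (left≤right c))))
                              (nothingBefore (left c) refl)
    where
    nothingBefore : ∀ q → q ≡ left c → before s q ≡ false
    nothingBefore zero    _  = refl
    nothingBefore (suc q) eq with s q in sq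
    ... | false = refl
    ... | true  = let (k , k≡q) = pointAt q (χ-below S q sq) in
      ⊥-elim (leftEdge k (trans (cong suc k≡q) eq) (χ⇒∈ (trans (cong s k≡q) sq)))

  -- the point just after a component a is not in S, so it cannot lie inside a
  -- component b that starts no later than a
  outlasts : ∀ a b → IsComponent S a → IsComponent S b → left b ≤ℕ left a → ¬ right a <ℕ right b
  outlasts a b (_ , _ , rightEdge) (inside , _ , _) lb≤la ra<rb =
    let (k , k≡x) = pointAt (suc (right a)) (≤-<-trans ra<rb (right<n b)) in
    rightEdge k k≡x (inside k (subst (λ y → inInterval (left b) (right b) y ≡ true) (sym k≡x)
      (inInterval-intro (≤-trans lb≤la (≤-trans (left≤right a) (n≤1+n _))) ra<rb)))

  component-unique : ∀ c c′ → IsComponent S c → IsComponent S c′ → left c ≡ left c′ → c ≡ c′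
  component-unique c c′ isC isC′ sameLeft with <-cmp (right c) (right c′)
  ... | tri≈ _ eq _   = root-ext c c′ sameLeft eq
  ... | tri< r<r′ _ _ = ⊥-elim (outlasts c c′ isC isC′ (≤-reflexive (sym sameLeft)) r<r′)
  ... | tri> _ _ r′<r = ⊥-elim (outlasts c′ c isC′ isC (≤-reflexive sameLeft) r′<r)

  runEnd : ∀ fuel p → n ≤ℕ p + fuel → s p ≡ true →
           ∃ λ b → p ≤ℕ b × (∀ x → p ≤ℕ x → x ≤ℕ b → s x ≡ true) × s (suc b) ≡ false
  runEnd zero p n≤p sp = ⊥-elim (<⇒≱ (χ-below S p sp) (subst (n ≤ℕ_) (+-identityʳ p) n≤p))
  runEnd (suc fuel) p n≤p sp with s (suc p) in sp′
  ... | false = p , ≤-refl , (λ x p≤x x≤p → subst (λ y → s y ≡ true) (≤-antisym p≤x x≤p) sp) , sp′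
  ... | true with runEnd fuel (suc p) (subst (n ≤ℕ_) (+-suc p fuel) n≤p) sp′
  ...   | b , p<b , holds , ends = b , ≤-trans (n≤1+n p) p<b , holds′ , ends
    where
    holds′ : ∀ x → p ≤ℕ x → x ≤ℕ b → s x ≡ true
    holds′ x p≤x x≤b with p ℕ.≟ x
    ... | yes refl = sp
    ... | no  p≢x  = holds x (≤∧≢⇒< p≤x p≢x) x≤b

  startsRun⇒component : ∀ p → startsRun s p ≡ true → ∃ λ c → IsComponent S c × left c ≡ p
  startsRun⇒component p start with s p in sp
  ... | true with runEnd n p (m≤n+m n p) sp
  ...   | b , p≤b , holds , ends = c , (inside , leftEdge , rightEdge) , left-mkRoot p b p≤b b<n
    where
    b<n : b <ℕ n
    b<n = χ-below S b (holds b p≤b ≤-refl)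
    c = mkRoot p b p≤b b<n
    inside : ∀ k → inSupp c k ≡ true → k ∈ S
    inside k k∈c = let (l≤k , k≤r) = inInterval-elim (left c) (right c) (toℕ k) k∈c in
      χ⇒∈ (holds (toℕ k) (subst (_≤ℕ toℕ k) (left-mkRoot p b p≤b b<n) l≤k)
                         (subst (toℕ k ≤ℕ_) (right-mkRoot p b p≤b b<n) k≤r))
    leftEdge : ∀ k → suc (toℕ k) ≡ left c → k ∉ S
    leftEdge k eq k∈S with trans (cong (λ y → not (before s y)) (trans eq (left-mkRoot p b p≤b b<n))) start
    ... | notBefore rewrite ∈⇒χ k∈S with notBefore
    ...   | ()
    rightEdge : ∀ k → toℕ k ≡ suc (right c) → k ∉ S
    rightEdge k eq k∈S with trans (sym ends) (trans (cong s (sym (trans eq (cong suc (right-mkRoot p b p≤b b<n))))) (∈⇒χ k∈S))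
    ... | ()

  isComponent : Root n → Bool
  isComponent c = does (IsComponent? S c)

  componentsAt : ∀ p → sumOver (λ c → ind (isComponent c ∧ (left c ≡ᵇ p))) (allRoots n) ≡ ind (startsRun s p)
  componentsAt p with startsRun s p in start
  ... | true = let (c , isC , lc≡p) = startsRun⇒component p start in
    ≤-antisym (count-atMostOne _ (allRoots-unique n) unique)
              (subst (_≤ℕ _) (cong ind (selected c isC lc≡p))
                     (sumOver-term (λ c → ind (isComponent c ∧ (left c ≡ᵇ p))) (∈-allRoots c)))
    where
    selected : ∀ c → IsComponent S c → left c ≡ p → (isComponent c ∧ (left c ≡ᵇ p)) ≡ true
    selected c isC refl = cong₂ _∧_ (dec-true (IsComponent? S c) isC) (dec-true (left c ℕ.≟ left c) refl)
    unique : ∀ {c c′} → c ∈L allRoots n → c′ ∈L allRoots n →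
             (isComponent c ∧ (left c ≡ᵇ p)) ≡ true → (isComponent c′ ∧ (left c′ ≡ᵇ p)) ≡ true → c ≡ c′
    unique {c} {c′} _ _ sel sel′ with isComponent c in isC | isComponent c′ in isC′
    ... | true | true = component-unique c c′ (witness (IsComponent? S c) isC) (witness (IsComponent? S c′) isC′)
                          (trans (witness (left c ℕ.≟ p) sel) (sym (witness (left c′ ℕ.≟ p) sel′)))
  ... | false = sumOver-zero _ (allRoots n) none
    where
    none : ∀ c → c ∈L allRoots n → ind (isComponent c ∧ (left c ≡ᵇ p)) ≡ 0
    none c _ with isComponent c in isC | left c ℕ.≟ p
    ... | false | _        = refl
    ... | true  | no c≢p   = cong ind (dec-false (left c ℕ.≟ p) c≢p)
    ... | true  | yes refl with trans (sym (component-startsRun c (witness (IsComponent? S c) isC))) start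
    ...   | ()

  components-count : length (components S) ≡ runs s n
  components-count = begin
    length (components S)
      ≡⟨ length-filter (IsComponent? S) (allRoots n) ⟩
    sumOver (λ c → ind (isComponent c)) (allRoots n)
      ≡⟨ sumOver-cong (allRoots n) (λ c _ → sym (locate c)) ⟩
    sumOver (λ c → Σ< n (λ p → ind (isComponent c ∧ (left c ≡ᵇ p)))) (allRoots n)
      ≡⟨ sym (Σ<-sumOver n (λ c p → ind (isComponent c ∧ (left c ≡ᵇ p))) (allRoots n)) ⟩
    Σ< n (λ p → sumOver (λ c → ind (isComponent c ∧ (left c ≡ᵇ p))) (allRoots n))
      ≡⟨ Σ<-cong n (λ p _ → componentsAt p) ⟩
    runs s n ∎
    where
    open ≡-Reasoning
    -- a root has exactly one left end, and it lies in [0, n)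
    locate : ∀ c → Σ< n (λ p → ind (isComponent c ∧ (left c ≡ᵇ p))) ≡ ind (isComponent c)
    locate c = begin
      Σ< n (λ p → ind (isComponent c ∧ (left c ≡ᵇ p))) ≡⟨ Σ<-point (isComponent c) (left c) n ⟩
      ind (isComponent c ∧ (left c <ᵇ n))
        ≡⟨ cong (λ b → ind (isComponent c ∧ b)) (dec-true (left c ℕ.<? n) (≤-<-trans (left≤right c) (right<n c))) ⟩
      ind (isComponent c ∧ true)                       ≡⟨ cong ind (BoolP.∧-identityʳ (isComponent c)) ⟩
      ind (isComponent c)                              ∎

  boundary-count : rank s (suc n) ≡ length (components S) + length (components S)
  boundary-count = begin
    rank s (suc n)                                ≡⟨ sym (+-identityʳ _) ⟩
    rank s (suc n) + 0                            ≡⟨ cong (λ b → rank s (suc n) + ind b) (sym sn) ⟩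
    rank s (suc n) + ind (s n)                    ≡⟨ telescope s (suc n) ⟩
    runs s n + ind (startsRun s n) + (runs s n + ind (startsRun s n))
      ≡⟨ cong (λ b → runs s n + ind (b ∧ not (before s n)) + (runs s n + ind (b ∧ not (before s n)))) sn ⟩
    runs s n + 0 + (runs s n + 0)                 ≡⟨ cong₂ _+_ (+-identityʳ (runs s n)) (+-identityʳ (runs s n)) ⟩
    runs s n + runs s n                           ≡⟨ cong₂ _+_ (sym components-count) (sym components-count) ⟩
    length (components S) + length (components S) ∎
    where
    open ≡-Reasoning
    sn : s n ≡ false
    sn = χ-outside S ≤-refl

-- Φ in terms of predicates on ℕ: the symmetric difference of the supports of a list
-- of roots holds at x iff an odd number of the supports contain x, so it has a
-- boundary point at p iff an odd number of the roots have an end (in the sense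
-- below) at p.

χ-⊕ : ∀ {n} (S T : Subset n) x → χ (S ⊕ T) x ≡ χ S x xor χ T x
χ-⊕ []      []      x       = refl
χ-⊕ (a ∷ S) (b ∷ T) zero    = refl
χ-⊕ (a ∷ S) (b ∷ T) (suc x) = χ-⊕ S T x

χ-empty : ∀ n x → χ (⊥ {n}) x ≡ false
χ-empty zero    x       = refl
χ-empty (suc n) zero    = refl
χ-empty (suc n) (suc x) = χ-empty n x

χ-supp : ∀ {n} (r : Root n) x → χ (supp r) x ≡ inInterval (left r) (right r) x
χ-supp {n} r x with x ℕ.<? n
... | yes x<n = let (k , k≡x) = pointAt x x<n in
  trans (cong (χ (supp r)) (sym k≡x))
        (trans (sym (χ-lookup (supp r) k))
               (trans (VecP.lookup∘tabulate (inSupp r) k) (cong (inInterval (left r) (right r)) k≡x)))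
... | no  x≮n = trans (χ-outside (supp r) (≮⇒≥ x≮n))
                      (sym (inInterval-above (left r) (<-≤-trans (right<n r) (≮⇒≥ x≮n))))

symDiff : ∀ {n} → List (Root n) → Subset n
symDiff gs = List.foldr _⊕_ ⊥ (List.map supp gs)

χ-symDiff : ∀ {n} (gs : List (Root n)) x → χ (symDiff gs) x ≡ xorOver (λ g → inInterval (left g) (right g) x) gs
χ-symDiff {n} []       x = χ-empty n x
χ-symDiff     (g ∷ gs) x = trans (χ-⊕ (supp g) (symDiff gs) x) (cong₂ _xor_ (χ-supp g x) (χ-symDiff gs x))

endpoint : ∀ {n} → Root n → ℕ → Bool
endpoint g p = (left g ≡ᵇ p) xor (suc (right g) ≡ᵇ p)

∂-symDiff : ∀ {n} (gs : List (Root n)) p → ∂ (χ (symDiff gs)) p ≡ xorOver (λ g → endpoint g p) gs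
∂-symDiff gs p = begin
  ∂ (χ (symDiff gs)) p
    ≡⟨ ∂-cong (χ-symDiff gs) p ⟩
  ∂ (λ x → xorOver (λ g → inInterval (left g) (right g) x) gs) p
    ≡⟨ ∂-xorOver (λ g → inInterval (left g) (right g)) gs p ⟩
  xorOver (λ g → ∂ (inInterval (left g) (right g)) p) gs
    ≡⟨ xorOver-cong gs (λ g _ → ∂-interval (left g) (right g) (left≤right g) p) ⟩
  xorOver (λ g → endpoint g p) gs ∎
  where open ≡-Reasoning

-- The two endpoint indicators of a root never fire together (left ≤ right < right + 1).

endpoint-split : ∀ {n} (g : Root n) p → ind (endpoint g p) ≡ ind (left g ≡ᵇ p) + ind (suc (right g) ≡ᵇ p)
endpoint-split g p with left g ≡ᵇ p in atLeft | suc (right g) ≡ᵇ p in atRight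
... | true  | true  = ⊥-elim (<⇒≢ (s≤s (left≤right g))
                        (trans (witness (left g ℕ.≟ p) atLeft) (sym (witness (suc (right g) ℕ.≟ p) atRight))))
... | true  | false = refl
... | false | true  = refl
... | false | false = refl

endpoint-hit : ∀ {n} (g : Root n) p → endpoint g p ≡ true → left g ≡ p ⊎ suc (right g) ≡ p
endpoint-hit g p hit with left g ≡ᵇ p in atLeft | suc (right g) ≡ᵇ p in atRight
... | true  | false = inj₁ (witness (left g ℕ.≟ p) atLeft)
... | false | true  = inj₂ (witness (suc (right g) ℕ.≟ p) atRight)

endpoint-intro : ∀ {n} (g : Root n) p → left g ≡ p ⊎ suc (right g) ≡ p → endpoint g p ≡ true
endpoint-intro g p (inj₁ refl) =
  cong₂ _xor_ (dec-true (left g ℕ.≟ left g) refl)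
              (dec-false (suc (right g) ℕ.≟ left g) (λ eq → <⇒≢ (s≤s (left≤right g)) (sym eq)))
endpoint-intro g p (inj₂ refl) =
  cong₂ _xor_ (dec-false (left g ℕ.≟ suc (right g)) (<⇒≢ (s≤s (left≤right g))))
              (dec-true (suc (right g) ℕ.≟ suc (right g)) refl)

-- Distinct generators (minimal members) of a set of roots are incomparable, so one
-- of them is shifted strictly to the right of the other.

generators-shifted : ∀ {n} {I : RootSet n} {g g′} → IsGen I g → IsGen I g′ → g ≢ g′ →
  (left g <ℕ left g′ × right g <ℕ right g′) ⊎ (left g′ <ℕ left g × right g′ <ℕ right g)
generators-shifted {g = g} {g′} (g∈ , gMin) (g′∈ , g′Min) g≢g′ with <-cmp (left g) (left g′)
... | tri< l<l′ _ _ with right g′ ℕ.≤? right g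
...   | yes r′≤r = ⊥-elim (g≢g′ (sym (gMin g′ g′∈ (⊆⇒≼ g′ g (<⇒≤ l<l′) r′≤r))))
...   | no  r′≰r = inj₁ (l<l′ , ≰⇒> r′≰r)
generators-shifted {g = g} {g′} (g∈ , gMin) (g′∈ , g′Min) g≢g′ | tri≈ _ l≡l′ _ with right g ℕ.≤? right g′
...   | yes r≤r′ = ⊥-elim (g≢g′ (g′Min g g∈ (⊆⇒≼ g g′ (≤-reflexive (sym l≡l′)) r≤r′)))
...   | no  r≰r′ = ⊥-elim (g≢g′ (sym (gMin g′ g′∈ (⊆⇒≼ g′ g (≤-reflexive l≡l′) (<⇒≤ (≰⇒> r≰r′))))))
generators-shifted {g = g} {g′} (g∈ , gMin) (g′∈ , g′Min) g≢g′ | tri> _ _ l′<l with right g ℕ.≤? right g′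
...   | yes r≤r′ = ⊥-elim (g≢g′ (g′Min g g∈ (⊆⇒≼ g g′ (<⇒≤ l′<l) r≤r′)))
...   | no  r≰r′ = inj₂ (l′<l , ≰⇒> r≰r′)

-- The window of a root r is the closed interval [left r, right r + 1].  Window S r
-- says that it contains more boundary points of S than S has components; this will
-- be the membership criterion for the abelian ideal with Φ-image S.

Window : ∀ {n} → Subset n → Root n → Set
Window S r = rank (χ S) (left r) + suc (length (components S)) ≤ℕ rank (χ S) (suc (suc (right r)))

-- They pairwise overlap and are pairwise
-- incomparable, hence strictly shifted against each other; so their 2k endpoints
-- left g, right g + 1 are pairwise distinct and are exactly the boundary points of
-- Φ(I).  Counting them gives #components Φ(I) = k, and counting those inside the
-- window of r decides whether r ∈ I (the criterion).

module AbelianIdeal {n} (I : RootSet n) (ab : IsAb I) where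

  gens : List (Root n)
  gens = generators I

  k : ℕ
  k = length gens

  gens-unique : Unique gens
  gens-unique = UniqueP.filter⁺ (IsGen? I) (allRoots-unique n)

  gen-of : ∀ {g} → g ∈L gens → IsGen I g
  gen-of g∈ = proj₂ (∈-filter⁻ (IsGen? I) {xs = allRoots n} g∈)

  ∈gens : ∀ {g} → IsGen I g → g ∈L gens
  ∈gens gen = ∈-filter⁺ (IsGen? I) (∈-allRoots _) gen

  endpoint-unique : ∀ p {g g′} → g ∈L gens → g′ ∈L gens → endpoint g p ≡ true → endpoint g′ p ≡ true → g ≡ g′
  endpoint-unique p {g} {g′} g∈ g′∈ hit hit′ with g ≟R g′
  ... | yes eq  = eq
  ... | no  g≢g′ = ⊥-elim (clash (endpoint-hit g p hit) (endpoint-hit g′ p hit′)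
                                  (generators-shifted (gen-of g∈) (gen-of g′∈) g≢g′))
    where
    l′≤r : left g′ ≤ℕ right g
    l′≤r = abelian-overlap ab g g′ (proj₁ (gen-of g∈)) (proj₁ (gen-of g′∈))
    l≤r′ : left g ≤ℕ right g′
    l≤r′ = abelian-overlap ab g′ g (proj₁ (gen-of g′∈)) (proj₁ (gen-of g∈))
    clash : left g ≡ p ⊎ suc (right g) ≡ p → left g′ ≡ p ⊎ suc (right g′) ≡ p →
      (left g <ℕ left g′ × right g <ℕ right g′) ⊎ (left g′ <ℕ left g × right g′ <ℕ right g) → Empty
    clash (inj₁ a) (inj₁ b) (inj₁ (lt , _)) = <⇒≢ lt (trans a (sym b))
    clash (inj₁ a) (inj₁ b) (inj₂ (lt , _)) = <⇒≢ lt (trans b (sym a))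
    clash (inj₂ a) (inj₂ b) (inj₁ (_ , lt)) = <⇒≢ (s≤s lt) (trans a (sym b))
    clash (inj₂ a) (inj₂ b) (inj₂ (_ , lt)) = <⇒≢ (s≤s lt) (trans b (sym a))
    clash (inj₁ a) (inj₂ b) _               = <⇒≢ (s≤s l≤r′) (trans a (sym b))
    clash (inj₂ a) (inj₁ b) _               = <⇒≢ (s≤s l′≤r) (trans b (sym a))

  s : ℕ → Bool
  s = χ (Φ I)

  #gens : (Root n → Bool) → ℕ
  #gens P = sumOver (λ g → ind (P g)) gens

  endpoints-atMostOne : ∀ p → #gens (λ g → endpoint g p) ≤ℕ 1
  endpoints-atMostOne p = count-atMostOne (λ g → endpoint g p) gens-unique (endpoint-unique p)

  boundary-count-at : ∀ p → ind (∂ s p) ≡ #gens (λ g → left g ≡ᵇ p) + #gens (λ g → suc (right g) ≡ᵇ p)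
  boundary-count-at p = begin
    ind (∂ s p)                                         ≡⟨ cong ind (∂-symDiff gens p) ⟩
    ind (xorOver (λ g → endpoint g p) gens)             ≡⟨ xorOver-count (λ g → endpoint g p) gens (endpoints-atMostOne p) ⟩
    #gens (λ g → endpoint g p)             ≡⟨ sumOver-cong gens (λ g _ → endpoint-split g p) ⟩
    sumOver (λ g → ind (left g ≡ᵇ p) + ind (suc (right g) ≡ᵇ p)) gens
                                                        ≡⟨ sumOver-+ _ _ gens ⟩
    #gens (λ g → left g ≡ᵇ p) + #gens (λ g → suc (right g) ≡ᵇ p) ∎
    where open ≡-Reasoning

  boundary⇒generator : ∀ p → ∂ s p ≡ true → ∃ λ g → IsGen I g × endpoint g p ≡ true
  boundary⇒generator p ∂p = let (g , g∈ , hit) = xorOver-true gens (trans (sym (∂-symDiff gens p)) ∂p) in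
    g , gen-of g∈ , hit

  generator⇒boundary : ∀ p {g} → IsGen I g → endpoint g p ≡ true → ∂ s p ≡ true
  generator⇒boundary p {g} gen hit = positive (begin
    1                                         ≡⟨ cong ind (sym hit) ⟩
    ind (endpoint g p)                        ≤⟨ sumOver-term (λ g → ind (endpoint g p)) (∈gens gen) ⟩
    #gens (λ g → endpoint g p)   ≡⟨ sym (xorOver-count (λ g → endpoint g p) gens (endpoints-atMostOne p)) ⟩
    ind (xorOver (λ g → endpoint g p) gens)   ≡⟨ cong ind (sym (∂-symDiff gens p)) ⟩
    ind (∂ s p)                               ∎)
    where
    open ≤-Reasoning
    positive : ∀ {b} → 1 ≤ℕ ind b → b ≡ true
    positive {true} _ = refl

  rank-Φ : ∀ c → rank s c ≡ #gens (λ g → left g <ᵇ c) + #gens (λ g → suc (right g) <ᵇ c)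
  rank-Φ c = begin
    Σ< c (λ p → ind (∂ s p))
      ≡⟨ Σ<-cong c (λ p _ → boundary-count-at p) ⟩
    Σ< c (λ p → #gens (λ g → left g ≡ᵇ p) + #gens (λ g → suc (right g) ≡ᵇ p))
      ≡⟨ Σ<-+ c _ _ ⟩
    Σ< c (λ p → #gens (λ g → left g ≡ᵇ p)) + Σ< c (λ p → #gens (λ g → suc (right g) ≡ᵇ p))
      ≡⟨ cong₂ _+_ (Σ<-sumOver c (λ g p → ind (left g ≡ᵇ p)) gens) (Σ<-sumOver c (λ g p → ind (suc (right g) ≡ᵇ p)) gens) ⟩
    sumOver (λ g → Σ< c (λ p → ind (left g ≡ᵇ p))) gens + sumOver (λ g → Σ< c (λ p → ind (suc (right g) ≡ᵇ p))) gens
      ≡⟨ cong₂ _+_ (sumOver-cong gens (λ g _ → Σ<-point true (left g) c))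
                   (sumOver-cong gens (λ g _ → Σ<-point true (suc (right g)) c)) ⟩
    #gens (λ g → left g <ᵇ c) + #gens (λ g → suc (right g) <ᵇ c) ∎
    where open ≡-Reasoning

  -- all 2k endpoints lie below n + 1
  rank-Φ-total : rank s (suc n) ≡ k + k
  rank-Φ-total = trans (rank-Φ (suc n)) (cong₂ _+_ (allBelow left (λ g → s≤s (≤-trans (left≤right g) (<⇒≤ (right<n g)))))
                                                 (allBelow (λ g → suc (right g)) (λ g → s≤s (right<n g))))
    where
    allBelow : ∀ (e : Root n → ℕ) → (∀ g → e g <ℕ suc n) → #gens (λ g → e g <ᵇ suc n) ≡ k
    allBelow e below = trans (sumOver-cong gens (λ g _ → cong ind (dec-true (e g ℕ.<? suc n) (below g))))
                             (sumOver-one gens)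

  components-Φ : length (components (Φ I)) ≡ k
  components-Φ = halve-injective _ _ (trans (sym (Components.boundary-count (Φ I))) rank-Φ-total)

  endpointsIn : ℕ → ℕ → ℕ
  endpointsIn a h = sumOver (λ g → ind (inInterval a h (left g)) + ind (inInterval a h (suc (right g)))) gens

  rank-window : ∀ a h → a ≤ℕ suc h → rank s (suc h) ≡ rank s a + endpointsIn a h
  rank-window a h a≤h+1 = begin
    rank s (suc h)
      ≡⟨ rank-Φ (suc h) ⟩
    #gens (λ g → left g <ᵇ suc h) + #gens (λ g → suc (right g) <ᵇ suc h)
      ≡⟨ cong₂ _+_ (splitAll left) (splitAll (λ g → suc (right g))) ⟩
    (#gens (λ g → left g <ᵇ a) + #gens (λ g → inInterval a h (left g))) +
    (#gens (λ g → suc (right g) <ᵇ a) + #gens (λ g → inInterval a h (suc (right g))))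
      ≡⟨ +-interchange (#gens (λ g → left g <ᵇ a)) _ (#gens (λ g → suc (right g) <ᵇ a)) _ ⟩
    (#gens (λ g → left g <ᵇ a) + #gens (λ g → suc (right g) <ᵇ a)) +
    (#gens (λ g → inInterval a h (left g)) + #gens (λ g → inInterval a h (suc (right g))))
      ≡⟨ cong₂ _+_ (sym (rank-Φ a)) (sym (sumOver-+ _ _ gens)) ⟩
    rank s a + endpointsIn a h ∎
    where
    open ≡-Reasoning
    splitAll : ∀ (e : Root n → ℕ) → #gens (λ g → e g <ᵇ suc h)
             ≡ #gens (λ g → e g <ᵇ a) + #gens (λ g → inInterval a h (e g))
    splitAll e = trans (sumOver-cong gens (λ g _ → below-split a h (e g) a≤h+1)) (sumOver-+ _ _ gens)

  -- a member r lies above some generator g₀; then every generator has an endpoint in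
  -- the window of r (by the shift between generators) and g₀ has both
  member⇒crowded : ∀ r → r ∈R I → suc k ≤ℕ endpointsIn (left r) (suc (right r))
  member⇒crowded r r∈I = sumOver-above _ atLeastOne (∈gens gen₀) (≤-reflexive (cong₂ _+_ (sym left₀-in) (sym right₀-in)))
    where
    g₀ = proj₁ (descent I r r∈I)
    gen₀ = proj₁ (proj₂ (descent I r r∈I))
    within = ≼⇒⊆ g₀ r (proj₂ (proj₂ (descent I r r∈I)))
    lr≤l₀ = proj₁ within
    r₀≤rr = proj₂ within
    inWindow : ∀ {x} → left r ≤ℕ x → x ≤ℕ suc (right r) → inInterval (left r) (suc (right r)) x ≡ true
    inWindow = inInterval-intro
    left₀-in = cong ind (inWindow lr≤l₀ (≤-trans (left≤right g₀) (≤-trans r₀≤rr (n≤1+n _))))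
    right₀-in = cong ind (inWindow (≤-trans lr≤l₀ (≤-trans (left≤right g₀) (n≤1+n _))) (s≤s r₀≤rr))
    atLeastOne : ∀ g → g ∈L gens → 1 ≤ℕ ind (inInterval (left r) (suc (right r)) (left g))
                                      + ind (inInterval (left r) (suc (right r)) (suc (right g)))
    atLeastOne g g∈ with g ≟R g₀
    ... | yes refl = ind-+-≥1 (inj₁ (inWindow lr≤l₀ (≤-trans (left≤right g₀) (≤-trans r₀≤rr (n≤1+n _)))))
    ... | no  g≢g₀ with generators-shifted (gen-of g∈) gen₀ g≢g₀
    ...   | inj₁ (_ , r<r₀) = ind-+-≥1 (inj₂ (inWindow
            (≤-trans lr≤l₀ (≤-trans (abelian-overlap ab g g₀ (proj₁ (gen-of g∈)) (proj₁ gen₀)) (n≤1+n _)))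
            (≤-trans r<r₀ (≤-trans r₀≤rr (n≤1+n _)))))
    ...   | inj₂ (l₀<l , _) = ind-+-≥1 (inj₁ (inWindow
            (≤-trans lr≤l₀ (<⇒≤ l₀<l))
            (≤-trans (abelian-overlap ab g₀ g (proj₁ gen₀) (proj₁ (gen-of g∈))) (≤-trans r₀≤rr (n≤1+n _)))))

  -- if r ∉ I, no generator lies below r, so no generator has both endpoints in the window
  crowded⇒member : ∀ r → suc k ≤ℕ endpointsIn (left r) (suc (right r)) → r ∈R I
  crowded⇒member r crowded with I r in r∈?
  ... | true  = refl
  ... | false = ⊥-elim (<⇒≱ crowded (≤-trans (sumOver-mono gens atMostOne) (≤-reflexive (sumOver-one gens))))
    where
    atMostOne : ∀ g → g ∈L gens → ind (inInterval (left r) (suc (right r)) (left g))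
                                  + ind (inInterval (left r) (suc (right r)) (suc (right g))) ≤ℕ 1
    atMostOne g g∈ = ind-+-≤1 λ leftIn rightIn →
      let (lr≤lg , _) = inInterval-elim (left r) (suc (right r)) (left g) leftIn
          (_ , rg<rr+1) = inInterval-elim (left r) (suc (right r)) (suc (right g)) rightIn
      in false≢true (trans (sym r∈?) (IsAb.upper ab g r (proj₁ (gen-of g∈)) (⊆⇒≼ g r lr≤lg (≤-pred rg<rr+1))))

  criterion : ∀ r → r ∈R I ⇔ Window (Φ I) r
  criterion r = mk⇔ (λ r∈I → subst₂ _≤ℕ_ (cong (λ c → rank s (left r) + suc c) (sym components-Φ)) (sym rankEq)
                                     (+-monoʳ-≤ (rank s (left r)) (member⇒crowded r r∈I)))
                    (λ win → crowded⇒member r (+-cancelˡ-≤ (rank s (left r)) _ _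
                               (subst₂ _≤ℕ_ (cong (λ c → rank s (left r) + suc c) components-Φ) rankEq win)))
    where
    rankEq : rank s (suc (suc (right r))) ≡ rank s (left r) + endpointsIn (left r) (suc (right r))
    rankEq = rank-window (left r) (suc (right r)) (≤-trans (left≤right r) (≤-trans (n≤1+n _) (n≤1+n _)))

-- Φ is injective: by the criterion, I is determined by Φ(I).

Φ-injective : ∀ {n} (I J : RootSet n) → IsAb I → IsAb J → Φ I ≡ Φ J → ∀ r → I r ≡ J r
Φ-injective I J abI abJ ΦI≡ΦJ r = BoolP.⇔→≡ (mk⇔
  (λ r∈I → Equivalence.from (AbelianIdeal.criterion J abJ r)
             (subst (λ S → Window S r) ΦI≡ΦJ (Equivalence.to (AbelianIdeal.criterion I abI r) r∈I)))
  (λ r∈J → Equivalence.from (AbelianIdeal.criterion I abI r)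
             (subst (λ S → Window S r) (sym ΦI≡ΦJ) (Equivalence.to (AbelianIdeal.criterion J abJ r) r∈J))))

-- For S ⊆ [n] with k components, the roots whose window holds more
-- than k of the 2k boundary points of S form an abelian ideal (windows of members
-- must overlap, as two disjoint windows would hold 2k + 1 points).  Its generators
-- are the windows [a, c - 1] between a boundary point a and the k-th boundary point
-- c after it, so its generators' endpoints are exactly the boundary points of S.

module WindowIdeal {n} (S : Subset n) where

  s : ℕ → Bool
  s = χ S

  k : ℕ
  k = length (components S)

  rank-bounded : ∀ c → c ≤ℕ suc n → rank s c ≤ℕ k + k
  rank-bounded c c≤n+1 = ≤-trans (rank-mono s c≤n+1) (≤-reflexive (Components.boundary-count S))

  window? : ∀ r → Dec (Window S r)
  window? r = rank s (left r) + suc k ℕ.≤? rank s (suc (suc (right r)))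

  ideal : RootSet n
  ideal r = does (window? r)

  member⇒window : ∀ r → r ∈R ideal → Window S r
  member⇒window r = witness (window? r)

  window⇒member : ∀ r → Window S r → r ∈R ideal
  window⇒member r = dec-true (window? r)

  window-end≤ : ∀ (r : Root n) → suc (suc (right r)) ≤ℕ suc n
  window-end≤ r = s≤s (right<n r)

  window⇒k≥1 : ∀ r → Window S r → 1 ≤ℕ k
  window⇒k≥1 r win = +-cancelˡ-≤ k 1 k (subst (_≤ℕ k + k) (+-comm 1 k)
    (≤-trans (m≤n+m (suc k) (rank s (left r))) (≤-trans win (rank-bounded _ (window-end≤ r)))))

  no-narrow-window : ∀ x → 1 ≤ℕ k → ¬ (rank s x + suc k ≤ℕ rank s (suc x))
  no-narrow-window x k≥1 win = <⇒≱ larger (≤-trans win (rank-step s x))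
    where
    larger : suc (rank s x) <ℕ rank s x + suc k
    larger = subst (suc (suc (rank s x)) ≤ℕ_) (sym (+-suc (rank s x) k))
                   (s≤s (subst (_≤ℕ rank s x + k) (+-comm (rank s x) 1) (+-monoʳ-≤ (rank s x) k≥1)))

  -- windows of members overlap: a window ending before another starts would leave
  -- at least k points up to its end and k + 1 further points in the other window
  members-overlap : ∀ x y → x ∈R ideal → y ∈R ideal → left y ≤ℕ right x
  members-overlap x y x∈ y∈ with left y ℕ.≤? right x
  ... | yes ok    = ok
  ... | no  apart = ⊥-elim (<⇒≱ tooMany (rank-bounded _ (window-end≤ y)))
    where
    k≤upToX : k ≤ℕ rank s (suc (right x))
    k≤upToX = ≤-pred (≤-trans (m≤n+m (suc k) (rank s (left x)))
                              (≤-trans (member⇒window x x∈) (rank-step s (suc (right x)))))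
    tooMany : k + k <ℕ rank s (suc (suc (right y)))
    tooMany = ≤-trans (≤-reflexive (sym (+-suc k k)))
                      (≤-trans (+-monoˡ-≤ (suc k) (≤-trans k≤upToX (rank-mono s (≰⇒> apart))))
                               (member⇒window y y∈))

  isAbelian : IsAb ideal
  isAbelian = record
    { upper   = λ ν γ ν∈ ν≼γ → let (lγ≤lν , rν≤rγ) = ≼⇒⊆ ν γ ν≼γ in window⇒member γ
        (≤-trans (+-monoˡ-≤ (suc k) (rank-mono s lγ≤lν))
                 (≤-trans (member⇒window ν ν∈) (rank-mono s (s≤s (s≤s rν≤rγ)))))
    ; abelian = λ γ γ′ γ∈ γ′∈ →
        overlapping-sum-not-root γ γ′ (members-overlap γ γ′ γ∈ γ′∈) (members-overlap γ′ γ γ′∈ γ∈)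
    }

  -- a generator cannot be shrunk, so both ends of its window are boundary points;
  -- a window [x, x + 1] is too narrow, and a longer one would lose no point when its
  -- end is not a boundary point, giving a smaller member
  generator-left-boundary : ∀ g → IsGen ideal g → ∂ s (left g) ≡ true
  generator-left-boundary g (g∈ , minimal) with ∂ s (left g) BoolP.≟ true
  ... | yes ∂l  = ∂l
  ... | no  ¬∂l = shrink (left g ℕ.<? right g)
    where
    win : Window S g
    win = member⇒window g g∈
    shrunk : rank s (suc (left g)) + suc k ≤ℕ rank s (suc (suc (right g)))
    shrunk = subst (λ c → c + suc k ≤ℕ rank s (suc (suc (right g)))) (sym (rank-skip s (left g) (BoolP.¬-not ¬∂l))) win
    shrink : Dec (left g <ℕ right g) → ∂ s (left g) ≡ true
    shrink (no l≮r) = ⊥-elim (no-narrow-window (suc (left g)) (window⇒k≥1 g win)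
      (subst (λ c → rank s (suc (left g)) + suc k ≤ℕ rank s (suc (suc c)))
             (sym (≤-antisym (left≤right g) (≮⇒≥ l≮r))) shrunk))
    shrink (yes l<r) = ⊥-elim (1+n≢n (trans (sym (left-mkRoot _ _ l<r (right<n g))) (cong left (minimal ν ν∈ ν≼g))))
      where
      ν = mkRoot (suc (left g)) (right g) l<r (right<n g)
      ν∈ : ν ∈R ideal
      ν∈ = window⇒member ν (subst₂ (λ a b → rank s a + suc k ≤ℕ rank s (suc (suc b)))
                                   (sym (left-mkRoot _ _ l<r (right<n g))) (sym (right-mkRoot _ _ l<r (right<n g))) shrunk)
      ν≼g : ν ≼ g
      ν≼g = ⊆⇒≼ ν g (subst (left g ≤ℕ_) (sym (left-mkRoot _ _ l<r (right<n g))) (n≤1+n _))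
                    (≤-reflexive (right-mkRoot _ _ l<r (right<n g)))

  generator-right-boundary : ∀ g → IsGen ideal g → ∂ s (suc (right g)) ≡ true
  generator-right-boundary g (g∈ , minimal) with ∂ s (suc (right g)) BoolP.≟ true
  ... | yes ∂r  = ∂r
  ... | no  ¬∂r = shrink (left g ℕ.<? right g)
    where
    win : Window S g
    win = member⇒window g g∈
    shrunk : rank s (left g) + suc k ≤ℕ rank s (suc (right g))
    shrunk = subst (rank s (left g) + suc k ≤ℕ_) (rank-skip s (suc (right g)) (BoolP.¬-not ¬∂r)) win
    shrink : Dec (left g <ℕ right g) → ∂ s (suc (right g)) ≡ true
    shrink (no l≮r) = ⊥-elim (no-narrow-window (left g) (window⇒k≥1 g win)
      (subst (λ c → rank s (left g) + suc k ≤ℕ rank s (suc c))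
             (sym (≤-antisym (left≤right g) (≮⇒≥ l≮r))) shrunk))
    shrink (yes l<r) with predecessor (≤-<-trans z≤n l<r)
    ... | b′ , b′+1≡r = ⊥-elim (<⇒≢ b′<r (trans (sym (right-mkRoot _ _ l≤b′ b′<n)) (cong right (minimal ν ν∈ ν≼g))))
      where
      b′<r : b′ <ℕ right g
      b′<r = ≤-reflexive b′+1≡r
      l≤b′ : left g ≤ℕ b′
      l≤b′ = ≤-pred (subst (suc (left g) ≤ℕ_) (sym b′+1≡r) l<r)
      b′<n : b′ <ℕ n
      b′<n = <-trans b′<r (right<n g)
      ν = mkRoot (left g) b′ l≤b′ b′<n
      ν∈ : ν ∈R ideal
      ν∈ = window⇒member ν (subst₂ (λ a b → rank s a + suc k ≤ℕ rank s (suc b))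
                                   (sym (left-mkRoot _ _ l≤b′ b′<n))
                                   (trans (sym b′+1≡r) (cong suc (sym (right-mkRoot _ _ l≤b′ b′<n)))) shrunk)
      ν≼g : ν ≼ g
      ν≼g = ⊆⇒≼ ν g (≤-reflexive (sym (left-mkRoot _ _ l≤b′ b′<n)))
                    (subst (_≤ℕ right g) (sym (right-mkRoot _ _ l≤b′ b′<n)) (<⇒≤ b′<r))

  -- a root whose window has boundary points at both ends and holds exactly k + 1 of
  -- them is a generator: the window of a smaller member would miss one of the ends
  tight-generator : ∀ g → ∂ s (left g) ≡ true → ∂ s (suc (right g)) ≡ true →
                    rank s (suc (right g)) ≡ rank s (left g) + k → IsGen ideal g
  tight-generator g ∂l ∂r tight = window⇒member g (≤-reflexive (sym windowCount)) , minimal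
    where
    windowCount : rank s (suc (suc (right g))) ≡ rank s (left g) + suc k
    windowCount = trans (rank-hit s (suc (right g)) ∂r) (trans (cong suc tight) (sym (+-suc (rank s (left g)) k)))
    minimal : ∀ ν → ν ∈R ideal → ν ≼ g → ν ≡ g
    minimal ν ν∈ ν≼g = root-ext ν g sameLeft sameRight
      where
      win = member⇒window ν ν∈
      lg≤lν = proj₁ (≼⇒⊆ ν g ν≼g)
      rν≤rg = proj₂ (≼⇒⊆ ν g ν≼g)
      sameLeft : left ν ≡ left g
      sameLeft with left g ℕ.<? left ν
      ... | no  lg≮lν = ≤-antisym (≮⇒≥ lg≮lν) lg≤lν
      ... | yes lg<lν = ⊥-elim (<⇒≱ (≤-trans (+-monoˡ-≤ (suc k) afterLeft) (≤-trans win windowν≤)) ≤-refl)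
        where
        afterLeft : suc (rank s (left g)) ≤ℕ rank s (left ν)
        afterLeft = subst (_≤ℕ rank s (left ν)) (rank-hit s (left g) ∂l) (rank-mono s lg<lν)
        windowν≤ : rank s (suc (suc (right ν))) ≤ℕ rank s (left g) + suc k
        windowν≤ = ≤-trans (rank-mono s (s≤s (s≤s rν≤rg))) (≤-reflexive windowCount)
      sameRight : right ν ≡ right g
      sameRight with right ν ℕ.<? right g
      ... | no  rν≮rg = ≤-antisym rν≤rg (≮⇒≥ rν≮rg)
      ... | yes rν<rg = ⊥-elim (<-irrefl refl (subst (_≤ℕ rank s (left g) + k) (+-suc (rank s (left g)) k)
                          (≤-trans (+-monoˡ-≤ (suc k) (rank-mono s lg≤lν))
                                   (≤-trans win (≤-trans (rank-mono s (s≤s rν<rg)) (≤-reflexive tight))))))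

  tight-pair-generator : ∀ a c → a <ℕ c → c ≤ℕ n → ∂ s a ≡ true → ∂ s c ≡ true → rank s c ≡ rank s a + k →
                         ∃ λ g → IsGen ideal g × left g ≡ a × suc (right g) ≡ c
  tight-pair-generator a c a<c c≤n ∂a ∂c tight with predecessor (≤-<-trans z≤n a<c)
  ... | b , refl = g , tight-generator g (subst (λ x → ∂ s x ≡ true) (sym lg≡a) ∂a)
                                         (subst (λ x → ∂ s (suc x) ≡ true) (sym rg≡b) ∂c)
                                         (subst₂ (λ x y → rank s (suc y) ≡ rank s x + k) (sym lg≡a) (sym rg≡b) tight)
                     , lg≡a , cong suc rg≡b
    where
    g = mkRoot a b (≤-pred a<c) c≤n
    lg≡a = left-mkRoot a b (≤-pred a<c) c≤n
    rg≡b = right-mkRoot a b (≤-pred a<c) c≤n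

  below-total : ∀ {t} → t <ℕ k + k → t <ℕ rank s (suc n)
  below-total {t} = subst (t <ℕ_) (sym (Components.boundary-count S))

  -- every boundary point p ends some generator: pair p with the boundary point k
  -- places after it when there is one, and with the one k places before it otherwise
  boundary⇒generator : ∀ p → ∂ s p ≡ true → ∃ λ g → IsGen ideal g × (left g ≡ p ⊎ suc (right g) ≡ p)
  boundary⇒generator p ∂p with rank s p ℕ.<? k
  ... | yes early =
    let (q , q<n+1 , rankq , ∂q) = rank-attains s (suc n) (rank s p + k) (below-total (+-monoˡ-< k early))
        p<q = rank-<⇒< s (subst (rank s p <ℕ_) (sym rankq) (m<m+n (rank s p) (≤-<-trans z≤n early)))
        (g , gen , lg≡p , _) = tight-pair-generator p q p<q (≤-pred q<n+1) ∂p ∂q rankq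
    in g , gen , inj₁ lg≡p
  ... | no late =
    let (a , _ , ranka , ∂a) = rank-attains s (suc n) (rank s p ∸ k)
                                 (below-total (≤-<-trans (m∸n≤m (rank s p) k) p-below-2k))
        k≥1 = +-cancelˡ-≤ k 1 k (subst (_≤ℕ k + k) (+-comm 1 k) (≤-trans (s≤s (≮⇒≥ late)) p-below-2k))
        a<p = rank-<⇒< s (subst (_<ℕ rank s p) (sym ranka) (∸-monoʳ-< k≥1 (≮⇒≥ late)))
        (g , gen , _ , rg≡p) = tight-pair-generator a p a<p (∂-bounded S p ∂p) ∂a ∂p
                                 (sym (trans (cong (_+ k) ranka) (m∸n+n≡m (≮⇒≥ late))))
    in g , gen , inj₂ rg≡p
    where
    p-below-2k : rank s p <ℕ k + k
    p-below-2k = ≤-trans (≤-reflexive (sym (rank-hit s p ∂p))) (rank-bounded (suc p) (s≤s (∂-bounded S p ∂p)))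

  -- hence Φ(ideal) and S have the same boundary points, so they are equal
  Φ-ideal : Φ ideal ≡ S
  Φ-ideal = χ-ext (Φ ideal) S (∂-injective (χ (Φ ideal)) s λ p → BoolP.⇔→≡ (mk⇔ (toS p) (fromS p)))
    where
    module A = AbelianIdeal ideal isAbelian
    generator-ends-boundary : ∀ {g} p → IsGen ideal g → left g ≡ p ⊎ suc (right g) ≡ p → ∂ s p ≡ true
    generator-ends-boundary {g} p gen (inj₁ refl) = generator-left-boundary g gen
    generator-ends-boundary {g} p gen (inj₂ refl) = generator-right-boundary g gen
    toS : ∀ p → ∂ (χ (Φ ideal)) p ≡ true → ∂ s p ≡ true
    toS p ∂p = let (g , gen , hit) = A.boundary⇒generator p ∂p in generator-ends-boundary p gen (endpoint-hit g p hit)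
    fromS : ∀ p → ∂ s p ≡ true → ∂ (χ (Φ ideal)) p ≡ true
    fromS p ∂p = let (g , gen , hit) = boundary⇒generator p ∂p in A.generator⇒boundary p gen (endpoint-intro g p hit)

theorem2p1 : (n : ℕ) →
    (∀ (I J : RootSet n) → IsAb I → IsAb J → Φ I ≡ Φ J → ∀ r → I r ≡ J r)
    × (∀ (S : Subset n) → ∃ λ (I : RootSet n) → IsAb I × Φ I ≡ S)
    × (∀ (I : RootSet n) → IsAb I → length (components (Φ I)) ≡ length (generators I))
theorem2p1 n = Φ-injective
             , (λ S → WindowIdeal.ideal S , WindowIdeal.isAbelian S , WindowIdeal.Φ-ideal S)
             , (λ I ab → AbelianIdeal.components-Φ I ab)
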